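{- The trees $\mathrm{C4'}=\forall x\forall y\big([\ ]\lor((\exists u/\{x\})[\ ]\land\forall z(\exists v/\{x,y\})[\ ])\big)$, $\mathrm{C5'}=\forall x\forall y\big([\ ]\lor\forall z((\exists u/\{x,z\})[\ ]\land(\exists v/\{x,y\})[\ ])\big)$ and $\mathrm{C6'}=\forall x\forall y\forall z\big([\ ]\lor((\exists u/\{x,z\})[\ ]\land(\exists v/\{x,y\})[\ ])\big)$ (where $[\ ]$ denotes a gap) are in FO.
   Context: IF logic: formulas from (negated) atoms by $\land,\lor$ and slashed quantifiers $(\exists v/V),(\forall v/V)$ with team semantics; $M\models\varphi$ iff $M,\{\emptyset\}\models\varphi$; $FV((Qv/V)\chi)=(FV(\chi)\setminus\{v\})\cup V$. A positive initial tree is a finite tree of quantifier and $\land,\lor$ occurrences; gaps $[\ ]$ mark the places where formulas may be attached; each gap determines a path (the branch from the root to it). A weak sentential completing function $e$ assigns to each path $P$ a quantifier-free formula with free variables among those quantified in $P$; $\hat e(T)$ is obtained by filling each gap with the assigned formula. $T$ is in FO if for every weak sentential completing function $e$ the class of finite models of $\hat e(T)$ is definable by a first-order sentence. -}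

module Defs where

open import Level using (Level; Lift) renaming (suc to lsuc; zero to lzero)
open import Data.Nat using (ℕ; suc)
open import Data.Fin using (Fin; zero; suc)
open import Data.Bool using (Bool; true; false)
open import Data.Vec using (Vec; []; _∷_; lookup; replicate; _[_]≔_)
open import Data.List using (List; []; _∷_; _++_)
open import Data.List.Membership.Propositional using (_∈_; _∉_)
open import Data.List.Relation.Unary.All using (All)
open import Data.Product using (Σ; _×_; _,_; proj₁)
open import Data.Sum using (_⊎_)
open import Data.Empty using (⊥)
open import Relation.Nullary using (¬_)
open import Relation.Binary.PropositionalEquality using (_≡_)
open import Function.Bundles using (_⇔_)

record Signature : Set₁ where
  field
    Fun   : Set
    funAr : Fun → ℕ
    Rel   : Set
    relAr : Rel → ℕ
open Signature public

module _ (σ : Signature) where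

  data Term (V : Set) : Set where
    var : V → Term V
    app : (f : Fun σ) → Vec (Term V) (funAr σ f) → Term V

  data Atom (V : Set) : Set where
    eq  : Term V → Term V → Atom V
    rel : (R : Rel σ) → Vec (Term V) (relAr σ R) → Atom V

  data Literal (V : Set) : Set where
    pos : Atom V → Literal V
    neg : Atom V → Literal V

  data QF (V : Set) : Set where
    lit : Literal V → QF V
    and : QF V → QF V → QF V
    or  : QF V → QF V → QF V

  -- IF formulas with variables Fin k; (∃ v / W) and (∀ v / W) slashed quantifiers
  data IF (k : ℕ) : Set where
    lit : Literal (Fin k) → IF k
    and : IF k → IF k → IF k
    or  : IF k → IF k → IF k
    ex  : (v : Fin k) (W : List (Fin k)) → IF k → IF k
    all : (v : Fin k) (W : List (Fin k)) → IF k → IF k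

  data FO : ℕ → Set where
    lit : ∀ {n} → Literal (Fin n) → FO n
    neg : ∀ {n} → FO n → FO n
    and : ∀ {n} → FO n → FO n → FO n
    or  : ∀ {n} → FO n → FO n → FO n
    ex  : ∀ {n} → FO (suc n) → FO n
    all : ∀ {n} → FO (suc n) → FO n

  qf→IF : ∀ {k} → QF (Fin k) → IF k
  qf→IF (lit l) = lit l
  qf→IF (and φ ψ) = and (qf→IF φ) (qf→IF ψ)
  qf→IF (or φ ψ) = or (qf→IF φ) (qf→IF ψ)

  mutual
    fvTerm : ∀ {V} → Term V → List V
    fvTerm (var x) = x ∷ []
    fvTerm (app f ts) = fvTerms ts

    fvTerms : ∀ {V n} → Vec (Term V) n → List V
    fvTerms [] = []
    fvTerms (t ∷ ts) = fvTerm t ++ fvTerms ts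

  fvAtom : ∀ {V} → Atom V → List V
  fvAtom (eq s t) = fvTerm s ++ fvTerm t
  fvAtom (rel R ts) = fvTerms ts

  fvLit : ∀ {V} → Literal V → List V
  fvLit (pos a) = fvAtom a
  fvLit (neg a) = fvAtom a

  fvQF : ∀ {V} → QF V → List V
  fvQF (lit l) = fvLit l
  fvQF (and φ ψ) = fvQF φ ++ fvQF ψ
  fvQF (or φ ψ) = fvQF φ ++ fvQF ψ

  record Structure (m : ℕ) : Set where
    field
      funI : (f : Fun σ) → Vec (Fin (suc m)) (funAr σ f) → Fin (suc m)
      relI : (R : Rel σ) → Vec (Fin (suc m)) (relAr σ R) → Bool
  open Structure public

  module _ {m : ℕ} (M : Structure m) where
    mutual
      evalTerm : ∀ {V} → (V → Fin (suc m)) → Term V → Fin (suc m)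
      evalTerm ρ (var x) = ρ x
      evalTerm ρ (app f ts) = funI M f (evalTerms ρ ts)

      evalTerms : ∀ {V n} → (V → Fin (suc m)) → Vec (Term V) n → Vec (Fin (suc m)) n
      evalTerms ρ [] = []
      evalTerms ρ (t ∷ ts) = evalTerm ρ t ∷ evalTerms ρ ts

    AtomHolds : ∀ {V} → (V → Fin (suc m)) → Atom V → Set
    AtomHolds ρ (eq s t) = evalTerm ρ s ≡ evalTerm ρ t
    AtomHolds ρ (rel R ts) = relI M R (evalTerms ρ ts) ≡ true

    LitHolds : ∀ {V} → (V → Fin (suc m)) → Literal V → Set
    LitHolds ρ (pos a) = AtomHolds ρ a
    LitHolds ρ (neg a) = ¬ AtomHolds ρ a

    ext : ∀ {n} → (Fin n → Fin (suc m)) → Fin (suc m) → Fin (suc n) → Fin (suc m)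
    ext ρ a zero = a
    ext ρ a (suc i) = ρ i

    SatFO : ∀ {n} → (Fin n → Fin (suc m)) → FO n → Set
    SatFO ρ (lit l) = LitHolds ρ l
    SatFO ρ (neg φ) = ¬ SatFO ρ φ
    SatFO ρ (and φ ψ) = SatFO ρ φ × SatFO ρ ψ
    SatFO ρ (or φ ψ) = SatFO ρ φ ⊎ SatFO ρ ψ
    SatFO ρ (ex φ) = Σ (Fin (suc m)) λ a → SatFO (ext ρ a) φ
    SatFO ρ (all φ) = (a : Fin (suc m)) → SatFO (ext ρ a) φ

    _⊨FO_ : FO 0 → Set
    _⊨FO_ ψ = SatFO (λ ()) ψ

    -- Team semantics (lax) for IF logic
    Assignment : ℕ → Set
    Assignment k = Vec (Fin (suc m)) k

    Team : ℕ → Set₁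
    Team k = Assignment k → Set

    AgreeOutside : ∀ {k} → List (Fin k) → Assignment k → Assignment k → Set
    AgreeOutside W s s' = ∀ w → w ∉ W → lookup s w ≡ lookup s' w

    supplement : ∀ {k} → Team k → Fin k → (Assignment k → Fin (suc m)) → Team k
    supplement X v F t = Σ (Assignment _) λ s → X s × (t ≡ s [ v ]≔ F s)
    duplicate : ∀ {k} → Team k → Fin k → Team k
    duplicate X v t = Σ (Assignment _) λ s → X s × Σ (Fin (suc m)) λ a → t ≡ s [ v ]≔ a

    TSat : ∀ {k} → Team k → IF k → Set₁
    TSat X (lit l) = Lift (lsuc lzero) (∀ s → X s → LitHolds (lookup s) l)
    TSat X (and φ ψ) = TSat X φ × TSat X ψ
    TSat X (or φ ψ) =
      Σ (Team _) λ Y → Σ (Team _) λ Z →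
        Lift (lsuc lzero) ((∀ s → X s → Y s ⊎ Z s) × (∀ s → Y s → X s) × (∀ s → Z s → X s))
        × TSat Y φ × TSat Z ψ
    TSat X (ex v W φ) =
      Σ (Assignment _ → Fin (suc m)) λ F →
        Lift (lsuc lzero) (∀ s s' → X s → X s' → AgreeOutside W s s' → F s ≡ F s')
        × TSat (supplement X v F) φ
    TSat X (all v W φ) = TSat (duplicate X v) φ

    -- M ⊨ φ iff M, {∅} ⊨ φ; the empty assignment is represented by the
    -- constant-zero total assignment
    _⊨IF_ : ∀ {k} → IF k → Set₁
    _⊨IF_ {k} φ = TSat (λ s → s ≡ replicate k zero) φ

data Tree (k : ℕ) : Set where
  gap : Tree k
  and : Tree k → Tree k → Tree k
  or  : Tree k → Tree k → Tree k
  ex  : (v : Fin k) (W : List (Fin k)) → Tree k → Tree k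
  all : (v : Fin k) (W : List (Fin k)) → Tree k → Tree k

data Gap {k : ℕ} : Tree k → Set where
  here  : Gap gap
  andL  : ∀ {T U} → Gap T → Gap (and T U)
  andR  : ∀ {T U} → Gap U → Gap (and T U)
  orL   : ∀ {T U} → Gap T → Gap (or T U)
  orR   : ∀ {T U} → Gap U → Gap (or T U)
  inEx  : ∀ {v W T} → Gap T → Gap (ex v W T)
  inAll : ∀ {v W T} → Gap T → Gap (all v W T)

quantified : ∀ {k} {T : Tree k} → Gap T → List (Fin k)
quantified here = []
quantified (andL g) = quantified g
quantified (andR g) = quantified g
quantified (orL g) = quantified g
quantified (orR g) = quantified g
quantified (inEx {v = v} g) = v ∷ quantified g
quantified (inAll {v = v} g) = v ∷ quantified g

WeakCompleting : (σ : Signature) {k : ℕ} → Tree k → Set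
WeakCompleting σ {k} T =
  (g : Gap T) → Σ (QF σ (Fin k)) λ φ → All (_∈ quantified g) (fvQF σ φ)

fill : (σ : Signature) {k : ℕ} (T : Tree k) → ((g : Gap T) → QF σ (Fin k)) → IF σ k
fill σ gap e = qf→IF σ (e here)
fill σ (and T U) e = and (fill σ T (λ g → e (andL g))) (fill σ U (λ g → e (andR g)))
fill σ (or T U) e = or (fill σ T (λ g → e (orL g))) (fill σ U (λ g → e (orR g)))
fill σ (ex v W T) e = ex v W (fill σ T (λ g → e (inEx g)))
fill σ (all v W T) e = all v W (fill σ T (λ g → e (inAll g)))

FODefinable : (σ : Signature) {k : ℕ} → IF σ k → Set₁
FODefinable σ φ =
  Σ (FO σ 0) λ ψ → (m : ℕ) (M : Structure σ m) → (_⊨IF_ σ M φ) ⇔ (_⊨FO_ σ M ψ)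

InFO : {k : ℕ} → Tree k → Set₁
InFO T = (σ : Signature) (e : WeakCompleting σ T) → FODefinable σ (fill σ T (λ g → proj₁ (e g)))

x y z u v : Fin 5
x = zero
y = suc zero
z = suc (suc zero)
u = suc (suc (suc zero))
v = suc (suc (suc (suc zero)))

C4' : Tree 5
C4' = all x [] (all y [] (or gap (and (ex u (x ∷ []) gap) (all z [] (ex v (x ∷ y ∷ []) gap)))))

C5' : Tree 5
C5' = all x [] (all y [] (or gap (all z [] (and (ex u (x ∷ z ∷ []) gap) (ex v (x ∷ y ∷ []) gap)))))

C6' : Tree 5
C6' = all x [] (all y [] (all z [] (or gap (and (ex u (x ∷ z ∷ []) gap) (ex v (x ∷ y ∷ []) gap)))))

-- In each tree the left disjunct is a quantifier-free formula α, which is flat, so the team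
-- splits into the points satisfying α and the rest, Z; on Z the slashes force u to depend on y
-- alone and v on z alone.  Since the universe is finite and α is decidable, a uniform choice
-- function on Z is constant on every slice y = b (resp. z = c) that meets Z, so the IF
-- sentence says exactly ∀y∃u∀x∀z(α ∨ β) ∧ ∀z∃v∀x∀y(α ∨ γ), which is first order.
module Submission where

open import Level using (lift)
open import Data.Nat using (ℕ; suc)
open import Data.Fin using (Fin; zero; suc)
import Data.Fin as Fin
open import Data.Fin.Properties using (any?)
open import Data.Bool using (true)
import Data.Bool as Bool
open import Data.Vec using (Vec; []; _∷_; lookup; replicate; _[_]≔_)
open import Data.List using (List; []; _∷_)
open import Data.List.Membership.Propositional using (_∈_; _∉_)
open import Data.List.Relation.Binary.Subset.Propositional.Properties using (xs⊆x∷xs; ∷⁺ʳ)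
open import Data.List.Relation.Unary.All as All using (All; []; _∷_)
open import Data.List.Relation.Unary.All.Properties using (++⁻)
open import Data.List.Relation.Unary.Any using (here; there)
open import Data.Product using (Σ; ∃; ∃₂; _×_; _,_; proj₁; proj₂)
open import Data.Sum using (_⊎_; [_,_]′)
import Data.Sum as Sum
open import Data.Empty using (⊥-elim)
open import Function using (_∘_; id)
open import Function.Bundles using (_⇔_; mk⇔; Equivalence)
import Function.Properties.Equivalence as ⇔
open import Relation.Nullary using (¬_; Dec; yes; no)
open import Relation.Nullary.Decidable using (_×-dec_; _⊎-dec_; ¬?; toSum)
open import Relation.Binary.PropositionalEquality using (_≡_; refl; cong; cong₂; subst)
open import Defs

open Equivalence using (to; from)

module Translation (σ : Signature) where

  mutual
    renameTerm : ∀ {V W} → (V → W) → Term σ V → Term σ W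
    renameTerm r (var i) = var (r i)
    renameTerm r (app f ts) = app f (renameTerms r ts)

    renameTerms : ∀ {V W n} → (V → W) → Vec (Term σ V) n → Vec (Term σ W) n
    renameTerms r [] = []
    renameTerms r (t ∷ ts) = renameTerm r t ∷ renameTerms r ts

  renameAtom : ∀ {V W} → (V → W) → Atom σ V → Atom σ W
  renameAtom r (eq s t) = eq (renameTerm r s) (renameTerm r t)
  renameAtom r (rel R ts) = rel R (renameTerms r ts)

  toFO : ∀ {V n} → (V → Fin n) → QF σ V → FO σ n
  toFO r (lit (pos a)) = lit (pos (renameAtom r a))
  toFO r (lit (neg a)) = lit (neg (renameAtom r a))
  toFO r (and φ ψ) = and (toFO r φ) (toFO r ψ)
  toFO r (or φ ψ) = or (toFO r φ) (toFO r ψ)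

module Semantics (σ : Signature) {m : ℕ} (M : Structure σ m) where
  open Translation σ

  D : Set
  D = Fin (suc m)

  QFHolds : ∀ {V} → (V → D) → QF σ V → Set
  QFHolds ρ (lit l) = LitHolds σ M ρ l
  QFHolds ρ (and φ ψ) = QFHolds ρ φ × QFHolds ρ ψ
  QFHolds ρ (or φ ψ) = QFHolds ρ φ ⊎ QFHolds ρ ψ

  AtomHolds? : ∀ {V} (ρ : V → D) a → Dec (AtomHolds σ M ρ a)
  AtomHolds? ρ (eq s t) = evalTerm σ M ρ s Fin.≟ evalTerm σ M ρ t
  AtomHolds? ρ (rel R ts) = relI M R (evalTerms σ M ρ ts) Bool.≟ true

  QFHolds? : ∀ {V} (ρ : V → D) φ → Dec (QFHolds ρ φ)
  QFHolds? ρ (lit (pos a)) = AtomHolds? ρ a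
  QFHolds? ρ (lit (neg a)) = ¬? (AtomHolds? ρ a)
  QFHolds? ρ (and φ ψ) = QFHolds? ρ φ ×-dec QFHolds? ρ ψ
  QFHolds? ρ (or φ ψ) = QFHolds? ρ φ ⊎-dec QFHolds? ρ ψ

  mutual
    evalTerm-rename : ∀ {V W} (ρ : W → D) (r : V → W) t →
                      evalTerm σ M ρ (renameTerm r t) ≡ evalTerm σ M (ρ ∘ r) t
    evalTerm-rename ρ r (var i) = refl
    evalTerm-rename ρ r (app f ts) = cong (funI M f) (evalTerms-rename ρ r ts)

    evalTerms-rename : ∀ {V W n} (ρ : W → D) (r : V → W) (ts : Vec (Term σ V) n) →
                       evalTerms σ M ρ (renameTerms r ts) ≡ evalTerms σ M (ρ ∘ r) ts
    evalTerms-rename ρ r [] = refl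
    evalTerms-rename ρ r (t ∷ ts) = cong₂ _∷_ (evalTerm-rename ρ r t) (evalTerms-rename ρ r ts)

  AtomHolds-rename : ∀ {V W} (ρ : W → D) (r : V → W) a →
                     AtomHolds σ M ρ (renameAtom r a) ≡ AtomHolds σ M (ρ ∘ r) a
  AtomHolds-rename ρ r (eq s t) = cong₂ _≡_ (evalTerm-rename ρ r s) (evalTerm-rename ρ r t)
  AtomHolds-rename ρ r (rel R ts) = cong (λ ds → relI M R ds ≡ true) (evalTerms-rename ρ r ts)

  SatFO-toFO : ∀ {V n} (ρ : Fin n → D) (r : V → Fin n) φ →
               SatFO σ M ρ (toFO r φ) ≡ QFHolds (ρ ∘ r) φ
  SatFO-toFO ρ r (lit (pos a)) = AtomHolds-rename ρ r a
  SatFO-toFO ρ r (lit (neg a)) = cong ¬_ (AtomHolds-rename ρ r a)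
  SatFO-toFO ρ r (and φ ψ) = cong₂ _×_ (SatFO-toFO ρ r φ) (SatFO-toFO ρ r ψ)
  SatFO-toFO ρ r (or φ ψ) = cong₂ _⊎_ (SatFO-toFO ρ r φ) (SatFO-toFO ρ r ψ)

  Agree : ∀ {V} → (V → D) → (V → D) → List V → Set
  Agree ρ ρ' = All (λ i → ρ i ≡ ρ' i)

  mutual
    evalTerm-cong : ∀ {V} {ρ ρ' : V → D} t → Agree ρ ρ' (fvTerm σ t) →
                    evalTerm σ M ρ t ≡ evalTerm σ M ρ' t
    evalTerm-cong (var i) (ρi≡ρ'i ∷ []) = ρi≡ρ'i
    evalTerm-cong (app f ts) eqs = cong (funI M f) (evalTerms-cong ts eqs)

    evalTerms-cong : ∀ {V n} {ρ ρ' : V → D} (ts : Vec (Term σ V) n) → Agree ρ ρ' (fvTerms σ ts) →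
                     evalTerms σ M ρ ts ≡ evalTerms σ M ρ' ts
    evalTerms-cong [] eqs = refl
    evalTerms-cong (t ∷ ts) eqs with ++⁻ (fvTerm σ t) eqs
    ... | eqs₁ , eqs₂ = cong₂ _∷_ (evalTerm-cong t eqs₁) (evalTerms-cong ts eqs₂)

  AtomHolds-cong : ∀ {V} {ρ ρ' : V → D} a → Agree ρ ρ' (fvAtom σ a) →
                   AtomHolds σ M ρ a ≡ AtomHolds σ M ρ' a
  AtomHolds-cong (eq s t) eqs with ++⁻ (fvTerm σ s) eqs
  ... | eqs₁ , eqs₂ = cong₂ _≡_ (evalTerm-cong s eqs₁) (evalTerm-cong t eqs₂)
  AtomHolds-cong (rel R ts) eqs = cong (λ ds → relI M R ds ≡ true) (evalTerms-cong ts eqs)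

  QFHolds-fv : ∀ {V} {ρ ρ' : V → D} φ → Agree ρ ρ' (fvQF σ φ) → QFHolds ρ φ ≡ QFHolds ρ' φ
  QFHolds-fv (lit (pos a)) eqs = AtomHolds-cong a eqs
  QFHolds-fv (lit (neg a)) eqs = cong ¬_ (AtomHolds-cong a eqs)
  QFHolds-fv (and φ ψ) eqs with ++⁻ (fvQF σ φ) eqs
  ... | eqs₁ , eqs₂ = cong₂ _×_ (QFHolds-fv φ eqs₁) (QFHolds-fv ψ eqs₂)
  QFHolds-fv (or φ ψ) eqs with ++⁻ (fvQF σ φ) eqs
  ... | eqs₁ , eqs₂ = cong₂ _⊎_ (QFHolds-fv φ eqs₁) (QFHolds-fv ψ eqs₂)

  ≡⇒⇔ : ∀ {A B : Set} → A ≡ B → A ⇔ B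
  ≡⇒⇔ refl = ⇔.refl

  QFHolds-cong : ∀ {V} {L : List V} {ρ ρ' : V → D} φ → All (_∈ L) (fvQF σ φ) → Agree ρ ρ' L →
                 QFHolds ρ φ ⇔ QFHolds ρ' φ
  QFHolds-cong φ fv eqs = ≡⇒⇔ (QFHolds-fv φ (All.map (All.lookup eqs) fv))

  SatFO-toFO-cong : ∀ {V n} {L : List V} {ρ : Fin n → D} {r : V → Fin n} {ρ' : V → D} φ →
                    All (_∈ L) (fvQF σ φ) → Agree (ρ ∘ r) ρ' L →
                    SatFO σ M ρ (toFO r φ) ⇔ QFHolds ρ' φ
  SatFO-toFO-cong {ρ = ρ} {r} φ fv eqs = ⇔.trans (≡⇒⇔ (SatFO-toFO ρ r φ)) (QFHolds-cong φ fv eqs)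

  Uniform : ∀ {k} → Team σ M k → List (Fin k) → (Assignment σ M k → D) → Set
  Uniform X W F = ∀ s s' → X s → X s' → AgreeOutside σ M W s s' → F s ≡ F s'

  Uniform-lookup : ∀ {k} {X : Team σ M k} {W} {i} (f : D → D) → i ∉ W →
                   Uniform X W (λ s → f (lookup s i))
  Uniform-lookup f i∉W s s' _ _ agree = cong f (agree _ i∉W)

  TSat-qf⁻ : ∀ {k} {X : Team σ M k} φ → TSat σ M X (qf→IF σ φ) → ∀ s → X s → QFHolds (lookup s) φ
  TSat-qf⁻ (lit l) (lift h) = h
  TSat-qf⁻ (and φ ψ) (hφ , hψ) s s∈X = TSat-qf⁻ φ hφ s s∈X , TSat-qf⁻ ψ hψ s s∈X
  TSat-qf⁻ (or φ ψ) (Y , Z , lift (cover , _ , _) , hφ , hψ) s s∈X =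
    Sum.map (TSat-qf⁻ φ hφ s) (TSat-qf⁻ ψ hψ s) (cover s s∈X)

  TSat-qf⁺ : ∀ {k} {X : Team σ M k} φ → (∀ s → X s → QFHolds (lookup s) φ) → TSat σ M X (qf→IF σ φ)
  TSat-qf⁺ (lit l) h = lift h
  TSat-qf⁺ (and φ ψ) h = TSat-qf⁺ φ (λ s → proj₁ ∘ h s) , TSat-qf⁺ ψ (λ s → proj₂ ∘ h s)
  TSat-qf⁺ {X = X} (or φ ψ) h =
    (λ s → X s × QFHolds (lookup s) φ) , (λ s → X s × QFHolds (lookup s) ψ) ,
    lift ((λ s s∈X → Sum.map (s∈X ,_) (s∈X ,_) (h s s∈X)) , (λ _ → proj₁) , (λ _ → proj₁)) ,
    TSat-qf⁺ φ (λ _ → proj₂) , TSat-qf⁺ ψ (λ _ → proj₂)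

  TSat-or-qf⁻ : ∀ {k} {X : Team σ M k} α φ → TSat σ M X (or (qf→IF σ α) φ) →
                Σ (Team σ M k) λ Z → (∀ s → X s → ¬ QFHolds (lookup s) α → Z s) × TSat σ M Z φ
  TSat-or-qf⁻ α φ (Y , Z , lift (cover , _ , _) , hα , hφ) = Z , toZ , hφ
    where
    toZ : ∀ s → _ → ¬ QFHolds (lookup s) α → Z s
    toZ s s∈X ¬α = [ ⊥-elim ∘ ¬α ∘ TSat-qf⁻ α hα s , id ]′ (cover s s∈X)

  TSat-or-qf⁺ : ∀ {k} {X : Team σ M k} α φ →
                TSat σ M (λ s → X s × ¬ QFHolds (lookup s) α) φ → TSat σ M X (or (qf→IF σ α) φ)
  TSat-or-qf⁺ {X = X} α φ hφ =
    (λ s → X s × QFHolds (lookup s) α) , (λ s → X s × ¬ QFHolds (lookup s) α) ,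
    lift ((λ s s∈X → Sum.map (s∈X ,_) (s∈X ,_) (toSum (QFHolds? (lookup s) α))) ,
          (λ _ → proj₁) , (λ _ → proj₁)) ,
    TSat-qf⁺ α (λ _ → proj₂) , hφ

  TSat-ex-qf⁻ : ∀ {k} {X : Team σ M k} {i W} φ → TSat σ M X (ex i W (qf→IF σ φ)) →
                Σ (Assignment σ M k → D) λ F →
                  Uniform X W F × (∀ s → X s → QFHolds (lookup (s [ i ]≔ F s)) φ)
  TSat-ex-qf⁻ φ (F , lift uniform , hφ) = F , uniform , λ s s∈X → TSat-qf⁻ φ hφ _ (s , s∈X , refl)

  TSat-ex-qf⁺ : ∀ {k} {X : Team σ M k} {i W} φ (F : Assignment σ M k → D) → Uniform X W F →
                (∀ s → X s → QFHolds (lookup (s [ i ]≔ F s)) φ) → TSat σ M X (ex i W (qf→IF σ φ))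
  TSat-ex-qf⁺ φ F uniform h = F , lift uniform , TSat-qf⁺ φ λ { _ (s , s∈X , refl) → h s s∈X }

  -- The family is only known to lie in X where P fails; if P holds everywhere any value will
  -- do, and deciding which case occurs is where finiteness of the universe is used.
  skolemValue : ∀ {k} {X : Team σ M k} {W} {F : Assignment σ M k → D}
                  {P : D → D → Set} {B : D → D → D → Set} →
                Uniform X W F → (pt : D → D → Assignment σ M k) →
                (∀ p q p' q' → AgreeOutside σ M W (pt p q) (pt p' q')) →
                (∀ p q → Dec (P p q)) →
                (∀ p q → ¬ P p q → X (pt p q)) →
                (∀ p q → ¬ P p q → B p q (F (pt p q))) →
                Σ D λ d → ∀ p q → P p q ⊎ B p q d
  skolemValue {F = F} {P} {B} uniform pt agree P? inX holdsB = d , λ p q →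
    Sum.map₂ (λ ¬P → subst (B p q) (F≡d p q ¬P) (holdsB p q ¬P)) (toSum (P? p q))
    where
    constant : Σ D λ d → ∀ p q → ¬ P p q → F (pt p q) ≡ d
    constant with any? (λ p → any? (λ q → ¬? (P? p q)))
    ... | yes (p₀ , q₀ , ¬P₀) =
      F (pt p₀ q₀) , λ p q ¬P → uniform _ _ (inX p q ¬P) (inX p₀ q₀ ¬P₀) (agree p q p₀ q₀)
    ... | no none = zero , λ p q ¬P → ⊥-elim (none (p , q , ¬P))

    d : D
    d = proj₁ constant

    F≡d : ∀ p q → ¬ P p q → F (pt p q) ≡ d
    F≡d = proj₂ constant

point : ∀ {A : Set} → A → A → A → A → A → Vec A 5
point a b c d e = a ∷ b ∷ c ∷ d ∷ e ∷ []

module Grid (σ : Signature) {m : ℕ} (M : Structure σ m) where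
  open Semantics σ M

  teamXY : Team σ M 5
  teamXY = duplicate σ M (duplicate σ M (λ s → s ≡ replicate 5 zero) x) y

  teamXYZ : Team σ M 5
  teamXYZ = duplicate σ M teamXY z

  teamXY-point : ∀ a b → teamXY (point a b zero zero zero)
  teamXY-point a b = point a zero zero zero zero , (replicate 5 zero , refl , a , refl) , b , refl

  teamXY-inv : ∀ {s} → teamXY s → ∃₂ λ a b → s ≡ point a b zero zero zero
  teamXY-inv (_ , (_ , refl , a , refl) , b , refl) = a , b , refl

  teamXYZ-point : ∀ a b c → teamXYZ (point a b c zero zero)
  teamXYZ-point a b c = point a b zero zero zero , teamXY-point a b , c , refl

  teamXYZ-inv : ∀ {s} → teamXYZ s → ∃₂ λ a b → ∃ λ c → s ≡ point a b c zero zero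
  teamXYZ-inv (_ , s∈ , c , refl) with teamXY-inv s∈
  ... | a , b , refl = a , b , c , refl

  agree-x : ∀ {a a' b c d e : D} → AgreeOutside σ M (x ∷ []) (point a b c d e) (point a' b c d e)
  agree-x zero x∉ = ⊥-elim (x∉ (here refl))
  agree-x (suc _) _ = refl

  agree-xy : ∀ {a a' b b' c d e : D} →
             AgreeOutside σ M (x ∷ y ∷ []) (point a b c d e) (point a' b' c d e)
  agree-xy zero x∉ = ⊥-elim (x∉ (here refl))
  agree-xy (suc zero) y∉ = ⊥-elim (y∉ (there (here refl)))
  agree-xy (suc (suc _)) _ = refl

  agree-xz : ∀ {a a' b c c' d e : D} →
             AgreeOutside σ M (x ∷ z ∷ []) (point a b c d e) (point a' b c' d e)
  agree-xz zero x∉ = ⊥-elim (x∉ (here refl))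
  agree-xz (suc zero) _ = refl
  agree-xz (suc (suc zero)) z∉ = ⊥-elim (z∉ (there (here refl)))
  agree-xz (suc (suc (suc _))) _ = refl

y∉x : y ∉ x ∷ []
y∉x (here ())
y∉x (there ())

y∉xz : y ∉ x ∷ z ∷ []
y∉xz (here ())
y∉xz (there (here ()))
y∉xz (there (there ()))

z∉xy : z ∉ x ∷ y ∷ []
z∉xy (here ())
z∉xy (there (here ()))
z∉xy (there (there ()))

module SkolemNormalForm (σ : Signature) (α β γ : QF σ (Fin 5))
  (fvα : All (_∈ x ∷ y ∷ z ∷ []) (fvQF σ α))
  (fvβ : All (_∈ x ∷ y ∷ z ∷ u ∷ []) (fvQF σ β))
  (fvγ : All (_∈ x ∷ y ∷ z ∷ v ∷ []) (fvQF σ γ)) where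
  open Translation σ

  -- de Bruijn positions in ∀y∃u∀x∀z and in ∀z∃v∀x∀y; v (resp. u) is not free in the
  -- formulas translated with it, so its image is arbitrary.
  fromYUXZ fromZVXY : Fin 5 → Fin 4
  fromYUXZ = lookup (point (suc zero) (suc (suc (suc zero))) zero (suc (suc zero)) zero)
  fromZVXY = lookup (point (suc zero) zero (suc (suc (suc zero))) zero (suc (suc zero)))

  sentence : FO σ 0
  sentence = and (all (ex (all (all (or (toFO fromYUXZ α) (toFO fromYUXZ β))))))
                 (all (ex (all (all (or (toFO fromZVXY α) (toFO fromZVXY γ))))))

  module _ {m : ℕ} (M : Structure σ m) where
    open Semantics σ M

    α̂ : D → D → D → Set
    α̂ a b c = QFHolds (lookup (point a b c zero zero)) α

    β̂ γ̂ : D → D → D → D → Set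
    β̂ a b c d = QFHolds (lookup (point a b c d zero)) β
    γ̂ a b c d = QFHolds (lookup (point a b c zero d)) γ

    SkolemCondition : Set
    SkolemCondition = (∀ b → ∃ λ d → ∀ a c → α̂ a b c ⊎ β̂ a b c d)
                    × (∀ c → ∃ λ d → ∀ a b → α̂ a b c ⊎ γ̂ a b c d)

    sentence⇔SkolemCondition : (_⊨FO_ σ M sentence) ⇔ SkolemCondition
    sentence⇔SkolemCondition = mk⇔ sound complete
      where
      sound : _⊨FO_ σ M sentence → SkolemCondition
      sound (h₁ , h₂) =
        (λ b → proj₁ (h₁ b) , λ a c →
          Sum.map (to (SatFO-toFO-cong α fvα (refl ∷ refl ∷ refl ∷ [])))
                  (to (SatFO-toFO-cong β fvβ (refl ∷ refl ∷ refl ∷ refl ∷ [])))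
                  (proj₂ (h₁ b) a c))
        , (λ c → proj₁ (h₂ c) , λ a b →
          Sum.map (to (SatFO-toFO-cong α fvα (refl ∷ refl ∷ refl ∷ [])))
                  (to (SatFO-toFO-cong γ fvγ (refl ∷ refl ∷ refl ∷ refl ∷ [])))
                  (proj₂ (h₂ c) a b))

      complete : SkolemCondition → _⊨FO_ σ M sentence
      complete (h₁ , h₂) =
        (λ b → proj₁ (h₁ b) , λ a c →
          Sum.map (from (SatFO-toFO-cong α fvα (refl ∷ refl ∷ refl ∷ [])))
                  (from (SatFO-toFO-cong β fvβ (refl ∷ refl ∷ refl ∷ refl ∷ [])))
                  (proj₂ (h₁ b) a c))
        , (λ c → proj₁ (h₂ c) , λ a b →
          Sum.map (from (SatFO-toFO-cong α fvα (refl ∷ refl ∷ refl ∷ [])))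
                  (from (SatFO-toFO-cong γ fvγ (refl ∷ refl ∷ refl ∷ refl ∷ [])))
                  (proj₂ (h₂ c) a b))

  definable : (φ : IF σ 5) → (∀ {m} (M : Structure σ m) → _⊨IF_ σ M φ ⇔ SkolemCondition M) →
              FODefinable σ φ
  definable φ φ⇔ = sentence , λ m M → ⇔.trans (φ⇔ M) (⇔.sym (sentence⇔SkolemCondition M))

module C4'-InFO (σ : Signature) (e : WeakCompleting σ C4') where
  αGap βGap γGap : Gap C4'
  αGap = inAll (inAll (orL here))
  βGap = inAll (inAll (orR (andL (inEx here))))
  γGap = inAll (inAll (orR (andR (inAll (inEx here)))))

  α β γ : QF σ (Fin 5)
  α = proj₁ (e αGap)
  β = proj₁ (e βGap)
  γ = proj₁ (e γGap)

  open SkolemNormalForm σ α β γ (All.map (∷⁺ʳ x (∷⁺ʳ y λ ())) (proj₂ (e αGap)))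
                                (All.map (∷⁺ʳ x (∷⁺ʳ y (xs⊆x∷xs (u ∷ []) z))) (proj₂ (e βGap)))
                                (proj₂ (e γGap))

  filled : IF σ 5
  filled = fill σ C4' (λ g → proj₁ (e g))

  rightDisjunct : IF σ 5
  rightDisjunct = and (ex u (x ∷ []) (qf→IF σ β)) (all z [] (ex v (x ∷ y ∷ []) (qf→IF σ γ)))

  module _ {m : ℕ} (M : Structure σ m) where
    open Semantics σ M
    open Grid σ M

    α-z-free : ∀ {a b c c'} → α̂ M a b c ⇔ α̂ M a b c'
    α-z-free = QFHolds-cong α (proj₂ (e αGap)) (refl ∷ refl ∷ [])

    β-z-free : ∀ {a b c c' d} → β̂ M a b c d ⇔ β̂ M a b c' d
    β-z-free = QFHolds-cong β (proj₂ (e βGap)) (refl ∷ refl ∷ refl ∷ [])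

    sound : _⊨IF_ σ M filled → SkolemCondition M
    sound sat with TSat-or-qf⁻ α rightDisjunct sat
    ... | Z , ¬α⇒Z , hβ , hγ with TSat-ex-qf⁻ β hβ | TSat-ex-qf⁻ γ hγ
    ... | F , F-uniform , Fβ | G , G-uniform , Gγ =
      (λ b → skolemValue F-uniform (λ a c → point a b zero zero zero) (λ _ _ _ _ → agree-x)
               (λ a c → QFHolds? _ α) (λ a c → inZ a b c) (λ a c → to β-z-free ∘ Fβ _ ∘ inZ a b c))
      , (λ c → skolemValue G-uniform (λ a b → point a b c zero zero) (λ _ _ _ _ → agree-xy)
               (λ a b → QFHolds? _ α) (λ a b → inZz a b c) (λ a b → Gγ _ ∘ inZz a b c))
      where
      inZ : ∀ a b c → ¬ α̂ M a b c → Z (point a b zero zero zero)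
      inZ a b c ¬α = ¬α⇒Z _ (teamXY-point a b) (¬α ∘ to α-z-free)

      inZz : ∀ a b c → ¬ α̂ M a b c → duplicate σ M Z z (point a b c zero zero)
      inZz a b c ¬α = _ , inZ a b c ¬α , c , refl

    complete : SkolemCondition M → _⊨IF_ σ M filled
    complete (h₁ , h₂) = TSat-or-qf⁺ α rightDisjunct
      ( TSat-ex-qf⁺ β _ (Uniform-lookup (proj₁ ∘ h₁) y∉x) βHolds
      , TSat-ex-qf⁺ γ _ (Uniform-lookup (proj₁ ∘ h₂) z∉xy) γHolds )
      where
      Z : Team σ M 5
      Z s = teamXY s × ¬ QFHolds (lookup s) α

      βHolds : ∀ s → Z s → QFHolds (lookup (s [ u ]≔ proj₁ (h₁ (lookup s y)))) β
      βHolds s (s∈ , ¬α) with teamXY-inv s∈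
      ... | a , b , refl = [ ⊥-elim ∘ ¬α , id ]′ (proj₂ (h₁ b) a zero)

      γHolds : ∀ s → duplicate σ M Z z s → QFHolds (lookup (s [ v ]≔ proj₁ (h₂ (lookup s z)))) γ
      γHolds _ (_ , (s∈ , ¬α) , c , refl) with teamXY-inv s∈
      ... | a , b , refl = [ ⊥-elim ∘ ¬α ∘ to α-z-free , id ]′ (proj₂ (h₂ c) a b)

  inFO : FODefinable σ filled
  inFO = definable filled λ M → mk⇔ (sound M) (complete M)

module C5'-InFO (σ : Signature) (e : WeakCompleting σ C5') where
  αGap βGap γGap : Gap C5'
  αGap = inAll (inAll (orL here))
  βGap = inAll (inAll (orR (inAll (andL (inEx here)))))
  γGap = inAll (inAll (orR (inAll (andR (inEx here)))))

  α β γ : QF σ (Fin 5)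
  α = proj₁ (e αGap)
  β = proj₁ (e βGap)
  γ = proj₁ (e γGap)

  open SkolemNormalForm σ α β γ (All.map (∷⁺ʳ x (∷⁺ʳ y λ ())) (proj₂ (e αGap)))
                                (proj₂ (e βGap)) (proj₂ (e γGap))

  filled : IF σ 5
  filled = fill σ C5' (λ g → proj₁ (e g))

  rightDisjunct : IF σ 5
  rightDisjunct = all z [] (and (ex u (x ∷ z ∷ []) (qf→IF σ β)) (ex v (x ∷ y ∷ []) (qf→IF σ γ)))

  module _ {m : ℕ} (M : Structure σ m) where
    open Semantics σ M
    open Grid σ M

    α-z-free : ∀ {a b c c'} → α̂ M a b c ⇔ α̂ M a b c'
    α-z-free = QFHolds-cong α (proj₂ (e αGap)) (refl ∷ refl ∷ [])

    sound : _⊨IF_ σ M filled → SkolemCondition M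
    sound sat with TSat-or-qf⁻ α rightDisjunct sat
    ... | Z , ¬α⇒Z , hβ , hγ with TSat-ex-qf⁻ β hβ | TSat-ex-qf⁻ γ hγ
    ... | F , F-uniform , Fβ | G , G-uniform , Gγ =
      (λ b → skolemValue F-uniform (λ a c → point a b c zero zero) (λ _ _ _ _ → agree-xz)
               (λ a c → QFHolds? _ α) (λ a c → inZ a b c) (λ a c → Fβ _ ∘ inZ a b c))
      , (λ c → skolemValue G-uniform (λ a b → point a b c zero zero) (λ _ _ _ _ → agree-xy)
               (λ a b → QFHolds? _ α) (λ a b → inZ a b c) (λ a b → Gγ _ ∘ inZ a b c))
      where
      inZ : ∀ a b c → ¬ α̂ M a b c → duplicate σ M Z z (point a b c zero zero)
      inZ a b c ¬α = _ , ¬α⇒Z _ (teamXY-point a b) (¬α ∘ to α-z-free) , c , refl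

    complete : SkolemCondition M → _⊨IF_ σ M filled
    complete (h₁ , h₂) = TSat-or-qf⁺ α rightDisjunct
      ( TSat-ex-qf⁺ β _ (Uniform-lookup (proj₁ ∘ h₁) y∉xz) βHolds
      , TSat-ex-qf⁺ γ _ (Uniform-lookup (proj₁ ∘ h₂) z∉xy) γHolds )
      where
      Z : Team σ M 5
      Z = duplicate σ M (λ s → teamXY s × ¬ QFHolds (lookup s) α) z

      βHolds : ∀ s → Z s → QFHolds (lookup (s [ u ]≔ proj₁ (h₁ (lookup s y)))) β
      βHolds _ (_ , (s∈ , ¬α) , c , refl) with teamXY-inv s∈
      ... | a , b , refl = [ ⊥-elim ∘ ¬α ∘ to α-z-free , id ]′ (proj₂ (h₁ b) a c)

      γHolds : ∀ s → Z s → QFHolds (lookup (s [ v ]≔ proj₁ (h₂ (lookup s z)))) γ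
      γHolds _ (_ , (s∈ , ¬α) , c , refl) with teamXY-inv s∈
      ... | a , b , refl = [ ⊥-elim ∘ ¬α ∘ to α-z-free , id ]′ (proj₂ (h₂ c) a b)

  inFO : FODefinable σ filled
  inFO = definable filled λ M → mk⇔ (sound M) (complete M)

module C6'-InFO (σ : Signature) (e : WeakCompleting σ C6') where
  αGap βGap γGap : Gap C6'
  αGap = inAll (inAll (inAll (orL here)))
  βGap = inAll (inAll (inAll (orR (andL (inEx here)))))
  γGap = inAll (inAll (inAll (orR (andR (inEx here)))))

  α β γ : QF σ (Fin 5)
  α = proj₁ (e αGap)
  β = proj₁ (e βGap)
  γ = proj₁ (e γGap)

  open SkolemNormalForm σ α β γ (proj₂ (e αGap)) (proj₂ (e βGap)) (proj₂ (e γGap))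

  filled : IF σ 5
  filled = fill σ C6' (λ g → proj₁ (e g))

  rightDisjunct : IF σ 5
  rightDisjunct = and (ex u (x ∷ z ∷ []) (qf→IF σ β)) (ex v (x ∷ y ∷ []) (qf→IF σ γ))

  module _ {m : ℕ} (M : Structure σ m) where
    open Semantics σ M
    open Grid σ M

    sound : _⊨IF_ σ M filled → SkolemCondition M
    sound sat with TSat-or-qf⁻ α rightDisjunct sat
    ... | Z , ¬α⇒Z , hβ , hγ with TSat-ex-qf⁻ β hβ | TSat-ex-qf⁻ γ hγ
    ... | F , F-uniform , Fβ | G , G-uniform , Gγ =
      (λ b → skolemValue F-uniform (λ a c → point a b c zero zero) (λ _ _ _ _ → agree-xz)
               (λ a c → QFHolds? _ α) (λ a c → inZ a b c) (λ a c → Fβ _ ∘ inZ a b c))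
      , (λ c → skolemValue G-uniform (λ a b → point a b c zero zero) (λ _ _ _ _ → agree-xy)
               (λ a b → QFHolds? _ α) (λ a b → inZ a b c) (λ a b → Gγ _ ∘ inZ a b c))
      where
      inZ : ∀ a b c → ¬ α̂ M a b c → Z (point a b c zero zero)
      inZ a b c = ¬α⇒Z _ (teamXYZ-point a b c)

    complete : SkolemCondition M → _⊨IF_ σ M filled
    complete (h₁ , h₂) = TSat-or-qf⁺ α rightDisjunct
      ( TSat-ex-qf⁺ β _ (Uniform-lookup (proj₁ ∘ h₁) y∉xz) βHolds
      , TSat-ex-qf⁺ γ _ (Uniform-lookup (proj₁ ∘ h₂) z∉xy) γHolds )
      where
      βHolds : ∀ s → teamXYZ s × ¬ QFHolds (lookup s) α →
               QFHolds (lookup (s [ u ]≔ proj₁ (h₁ (lookup s y)))) β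
      βHolds s (s∈ , ¬α) with teamXYZ-inv s∈
      ... | a , b , c , refl = [ ⊥-elim ∘ ¬α , id ]′ (proj₂ (h₁ b) a c)

      γHolds : ∀ s → teamXYZ s × ¬ QFHolds (lookup s) α →
               QFHolds (lookup (s [ v ]≔ proj₁ (h₂ (lookup s z)))) γ
      γHolds s (s∈ , ¬α) with teamXYZ-inv s∈
      ... | a , b , c , refl = [ ⊥-elim ∘ ¬α , id ]′ (proj₂ (h₂ c) a b)

  inFO : FODefinable σ filled
  inFO = definable filled λ M → mk⇔ (sound M) (complete M)

mainTheorem15 : InFO C4' × InFO C5' × InFO C6'
mainTheorem15 = C4'-InFO.inFO , C5'-InFO.inFO , C6'-InFO.inFO
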